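{- If $S$ is a strict cutset of a D-graph $D$, then there are at least two componential extremes in $C_S(D)$.
   Context: A graph is a pair of functions $W,E\colon A\to V$ with $A\cap V=\emptyset$. A vertex $v$ is a $W$-vertex if no edge $a$ has $E(a)=v$, an $E$-vertex if no edge $a$ has $W(a)=v$; inner if neither. An edge $a$ is a $W$-edge if $W(a)$ is a $W$-vertex, an $E$-edge if $E(a)$ is an $E$-vertex, inner if neither. $W$-$E$-functional: every $W$-edge $a$ has $W(a)\ne W(b)$ for all edges $b\ne a$, and every $E$-edge $a$ has $E(a)\ne E(b)$ for all $b\ne a$. Semipaths are sequences $v_0a_1v_1\dots a_nv_n$ with $\{W(a_i),E(a_i)\}=\{v_{i-1},v_i\}$ and no repeated vertex; weakly connected: any two distinct vertices are joined by a semipath; acyclic: no directed closed walk $v_0a_1\dots a_nv_n$, $n\ge1$, $W(a_i)=v_{i-1}$, $E(a_i)=v_i$, vertices distinct except $v_0=v_n$. A D-graph is a finite, acyclic, $W$-$E$-functional, weakly connected graph with an inner vertex. For a set $S$ of inner edges of a D-graph $D$, removing the edges of $S$ (keeping all vertices) yields a graph with weakly connected components $D_1,\dots,D_n$. The componential graph $C_S(D)$ is the directed graph (irreflexive relation) on $\{D_1,\dots,D_n\}$ with an arc $(D_i,D_j)$ iff $i\ne j$ and some $a\in S$ has $W(a)$ in $D_i$ and $E(a)$ in $D_j$. $S$ is a strict cutset if $n\ge2$, for each $a\in S$ the vertices $W(a),E(a)$ lie in distinct components, and $C_S(D)$ is acyclic. A vertex $D_i$ of $C_S(D)$ is inner if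 there are arcs $(D_j,D_i)$ and $(D_i,D_k)$, and outer otherwise. $D_i$ is a cutvertex if removing $D_i$ and all arcs containing it increases the number of weakly connected components. A componential extreme is an outer vertex of $C_S(D)$ that is not a cutvertex. -}

module Defs where

open import Data.Nat using (ℕ; _≤_; _<_)
open import Data.Fin using (Fin)
open import Data.Fin.Subset using (Subset; _∈_; _∉_)
open import Data.List using (List; []; _∷_)
open import Data.List.Relation.Unary.Unique.Propositional using (Unique)
open import Data.Product using (Σ; ∃; _×_; proj₁)
open import Data.Sum using (_⊎_)
open import Data.Unit using (⊤)
open import Relation.Nullary using (¬_)
open import Relation.Binary.PropositionalEquality using (_≡_; _≢_)
open import Function.Bundles using (_⇔_)

data SPath {X : Set} (R : X → X → Set) : X → X → List X → Set where
  here  : ∀ {v} → SPath R v v (v ∷ [])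
  there : ∀ {u w v vs} → R u w → SPath R w v vs → SPath R u v (u ∷ vs)

Semipath : {X : Set} → (X → X → Set) → X → X → Set
Semipath {X} R u v = Σ (List X) λ vs → SPath R u v vs × Unique vs

-- directed closed walk v₀ a₁ v₁ … aₙ vₙ, n ≥ 1, vertices distinct except v₀ = vₙ
-- (R is the directed arc relation)
DirCycle : {X : Set} → (X → X → Set) → Set
DirCycle {X} R = Σ X λ u → Σ X λ w → Σ (List X) λ vs →
  R u w × SPath R w u vs × Unique vs

-- Graphs with finitely many edges Fin m and vertices Fin k
-- (edges and vertices live in different types, so A ∩ V = ∅).

record Graph (m k : ℕ) : Set where
  field
    W : Fin m → Fin k
    E : Fin m → Fin k

module _ {m k : ℕ} (G : Graph m k) where
  open Graph G

  DArc : Fin k → Fin k → Set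
  DArc u v = Σ (Fin m) λ a → W a ≡ u × E a ≡ v

  UStep : (Fin m → Set) → Fin k → Fin k → Set
  UStep ok u w = Σ (Fin m) λ a → ok a ×
    ((W a ≡ u × E a ≡ w) ⊎ (W a ≡ w × E a ≡ u))

  IsWVertex : Fin k → Set
  IsWVertex v = ¬ (Σ (Fin m) λ a → E a ≡ v)

  IsEVertex : Fin k → Set
  IsEVertex v = ¬ (Σ (Fin m) λ a → W a ≡ v)

  IsInnerVertex : Fin k → Set
  IsInnerVertex v = ¬ IsWVertex v × ¬ IsEVertex v

  IsWEdge : Fin m → Set
  IsWEdge a = IsWVertex (W a)

  IsEEdge : Fin m → Set
  IsEEdge a = IsEVertex (E a)

  IsInnerEdge : Fin m → Set
  IsInnerEdge a = ¬ IsWEdge a × ¬ IsEEdge a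

  WEFunctional : Set
  WEFunctional =
    (∀ a → IsWEdge a → ∀ b → b ≢ a → W a ≢ W b) ×
    (∀ a → IsEEdge a → ∀ b → b ≢ a → E a ≢ E b)

  WeaklyConnected : Set
  WeaklyConnected = ∀ u v → u ≢ v → Semipath (UStep (λ _ → ⊤)) u v

  Acyclic : Set
  Acyclic = ¬ DirCycle DArc

  -- D-graph (finiteness is built in: Fin m, Fin k)
  IsDGraph : Set
  IsDGraph = Acyclic × WEFunctional × WeaklyConnected × Σ (Fin k) IsInnerVertex

  -- c : Fin k → Fin n labels the weakly connected components D₁,…,Dₙ of
  -- the graph obtained by removing the edges of S (keeping all vertices):
  -- c is onto, and c u ≡ c v iff u = v or u, v are joined by a semipath
  -- avoiding S.
  IsComponentLabelling : Subset m → (n : ℕ) → (Fin k → Fin n) → Set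
  IsComponentLabelling S n c =
    (∀ i → Σ (Fin k) λ v → c v ≡ i) ×
    (∀ u v → (c u ≡ c v) ⇔ (u ≡ v ⊎ Semipath (UStep (λ a → a ∉ S)) u v))

  CArc : Subset m → {n : ℕ} → (Fin k → Fin n) → Fin n → Fin n → Set
  CArc S c i j = i ≢ j × Σ (Fin m) λ a → a ∈ S × c (W a) ≡ i × c (E a) ≡ j

-- Number of weakly connected components of a directed graph given by an
-- arc relation R on X, restricted to the vertices satisfying P (arcs with
-- an endpoint outside P are removed).  "r components" means there is an
-- onto labelling of the vertices by Fin r whose kernel is weak connectivity.

UndirRestr : {X : Set} → (X → Set) → (X → X → Set) → X → X → Set
UndirRestr P R x y = P x × P y × (R x y ⊎ R y x)

HasComponentCount : {X : Set} → (X → Set) → (X → X → Set) → ℕ → Set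
HasComponentCount {X} P R r =
  Σ (Σ X P → Fin r) λ f →
    (∀ t → Σ (Σ X P) λ x → f x ≡ t) ×
    (∀ x y → (f x ≡ f y) ⇔
       (proj₁ x ≡ proj₁ y ⊎ Semipath (UndirRestr P R) (proj₁ x) (proj₁ y)))

module _ {n : ℕ} (R : Fin n → Fin n → Set) where

  IsInnerC : Fin n → Set
  IsInnerC i = (Σ (Fin n) λ j → R j i) × (Σ (Fin n) λ l → R i l)

  IsOuterC : Fin n → Set
  IsOuterC i = ¬ IsInnerC i

  IsCutvertex : Fin n → Set
  IsCutvertex i = Σ ℕ λ r → Σ ℕ λ r' →
    HasComponentCount (λ _ → ⊤) R r ×
    HasComponentCount (λ j → j ≢ i) R r' ×
    r < r'

  IsExtreme : Fin n → Set
  IsExtreme i = IsOuterC i × ¬ IsCutvertex i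

module _ {m k : ℕ} (G : Graph m k) where
  open Graph G

  IsStrictCutset : Subset m → (n : ℕ) → (Fin k → Fin n) → Set
  IsStrictCutset S n c =
    (∀ a → a ∈ S → IsInnerEdge G a) ×
    2 ≤ n ×
    (∀ a → a ∈ S → c (W a) ≢ c (E a)) ×
    Acyclic' (CArc G S c)
    where
      Acyclic' : (Fin n → Fin n → Set) → Set
      Acyclic' R = ¬ DirCycle R

-- Only the weak connectivity of D is needed: through the labelling it makes
-- C_S(D) a weakly connected finite acyclic digraph with at least two vertices,
-- and every such digraph has two distinct outer vertices that are not cutvertices.
--
-- Fix a root x. Call a vertex set U a region rooted at x if U is connected to x
-- and contains all neighbours of its vertices other than x; then a source or a
-- sink of U other than x is outer in the whole digraph, and acyclicity provides
-- one. If removing such a v still leaves U connected to x we are done. Otherwise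
-- the vertices of U that v cuts off from x (v among them) form a strictly smaller
-- region rooted at v, and an outer vertex v′ found there recursively is removable
-- from U as well: what reaches x avoiding v avoids v′, and the rest reaches v
-- avoiding v′ and then x through a neighbour of v. Applying this to the whole
-- vertex set rooted at x₀ gives v₁, and rooted at v₁ gives v₂ ≠ v₁.

module Submission where

open import Defs
open import Data.Empty using (⊥; ⊥-elim)
open import Data.Fin as Fin using (Fin; zero; suc)
open import Data.Fin.Properties using (_≟_; any?)
open import Data.Fin.Subset using (Subset; inside; outside; _∈_; _∉_; _⊂_; _⊆_; _─_; _-_)
  renaming (⊤ to ⊤ˢ)
open import Data.Fin.Subset.Induction using (⊂-wellFounded)
open import Data.Fin.Subset.Properties
  using (_∈?_; ∈⊤; p─q⊆p; x∈p∧x≢y⇒x∈p-y; x∈p⇒p-x⊂p; x∈⁅x⁆)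
open import Data.List.Relation.Unary.Any as Any using (Any; here; there)
open import Data.List.Relation.Unary.All using ([]; _∷_)
open import Data.List.Relation.Unary.All.Properties using (¬Any⇒All¬)
open import Data.List.Relation.Unary.AllPairs using ([]; _∷_)
open import Data.List.Relation.Unary.Unique.Propositional using (Unique)
open import Data.Nat using (ℕ; zero; suc; s≤s)
open import Data.Product using (Σ; _×_; _,_; proj₁; proj₂)
open import Data.Sum using (_⊎_; inj₁; inj₂; [_,_])
open import Data.Unit using (⊤; tt)
open import Data.Vec using (_∷_; tabulate; here; there)
open import Data.Vec.Properties using (lookup⇒[]=; []=⇒lookup; lookup∘tabulate)
open import Function using (_∘_; flip; id)
open import Function.Bundles using (Equivalence)
open import Induction.WellFounded using (Acc; acc)
open import Relation.Binary.Construct.Closure.Equivalence using (EqClosure)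
open import Relation.Binary.Construct.Closure.ReflexiveTransitive as Star
  using (Star; ε; _◅_; _◅◅_)
open import Relation.Binary.Construct.Closure.Symmetric using (SymClosure; fwd; bwd)
open import Relation.Binary.Definitions using (DecidableEquality)
open import Relation.Binary.PropositionalEquality using (_≡_; _≢_; refl; sym; trans; subst)
open import Relation.Nullary using (¬_; Dec; yes; no; does)
open import Relation.Nullary.Decidable using (dec-true; decidable-stable; _×-dec_; _⊎-dec_; ¬?)

private
  variable
    X : Set
    n : ℕ

-- Loop erasure

module _ (_≟ˣ_ : DecidableEquality X) {Q : X → X → Set} where

  private
    semipath-suffix : ∀ {x y z vs} → SPath Q y z vs → Unique vs → Any (x ≡_) vs →
                      Semipath Q x z
    semipath-suffix here         u       (here refl) = _ , here , u
    semipath-suffix (there q sp) u       (here refl) = _ , there q sp , u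
    semipath-suffix (there _ sp) (_ ∷ u) (there x∈) = semipath-suffix sp u x∈

  walk⇒semipath : ∀ {x z} → Star Q x z → Semipath Q x z
  walk⇒semipath ε = _ , here , [] ∷ []
  walk⇒semipath {x} (q ◅ p) with walk⇒semipath p
  ... | vs , sp , u with Any.any? (x ≟ˣ_) vs
  ...   | yes x∈vs = semipath-suffix sp u x∈vs
  ...   | no  x∉vs = _ , there q sp , ¬Any⇒All¬ vs x∉vs ∷ u


x∈p─q⇒x∉q : {p q : Subset n} {x : Fin n} → x ∈ p ─ q → x ∉ q
x∈p─q⇒x∉q {p = _ ∷ _} {q = outside ∷ _} here        ()
x∈p─q⇒x∉q {p = _ ∷ _} {q = outside ∷ _} (there x∈) (there x∈q) = x∈p─q⇒x∉q x∈ x∈q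
x∈p─q⇒x∉q {p = _ ∷ _} {q = inside  ∷ _} (there x∈) (there x∈q) = x∈p─q⇒x∉q x∈ x∈q

x∈p-y⇒x≢y : {p : Subset n} {x y : Fin n} → x ∈ p - y → x ≢ y
x∈p-y⇒x≢y x∈ refl = x∈p─q⇒x∉q x∈ (x∈⁅x⁆ _)

x∈p-y⇒x∈p : {p : Subset n} {x y : Fin n} → x ∈ p - y → x ∈ p
x∈p-y⇒x∈p {p = p} = p─q⊆p p _

p⊆q⇒p-x⊆q-x : {p q : Subset n} {x : Fin n} → p ⊆ q → p - x ⊆ q - x
p⊆q⇒p-x⊆q-x p⊆q y∈ = x∈p∧x≢y⇒x∈p-y (p⊆q (x∈p-y⇒x∈p y∈)) (x∈p-y⇒x≢y y∈)

toSubset : {P : Fin n → Set} → (∀ x → Dec (P x)) → Subset n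
toSubset P? = tabulate (λ x → does (P? x))

module _ {P : Fin n → Set} (P? : ∀ x → Dec (P x)) where

  ∈-toSubset⁺ : ∀ {x} → P x → x ∈ toSubset P?
  ∈-toSubset⁺ {x} px = lookup⇒[]= x _ (trans (lookup∘tabulate _ x) (dec-true (P? x) px))

  ∈-toSubset⁻ : ∀ {x} → x ∈ toSubset P? → P x
  ∈-toSubset⁻ {x} x∈
    with P? x | trans (sym (lookup∘tabulate (λ x → does (P? x)) x)) ([]=⇒lookup x∈)
  ... | yes px | _ = px
  ... | no  _  | ()

module _ {n : ℕ} (R : Fin n → Fin n → Set) where

  Adj : Fin n → Fin n → Set
  Adj x y = R x y ⊎ R y x

  Link : Subset n → Fin n → Fin n → Set
  Link U = UndirRestr (_∈ U) R

  Walk : Subset n → Fin n → Fin n → Set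
  Walk U = Star (Link U)

  Removable : Subset n → Fin n → Fin n → Set
  Removable U x v = ∀ {z} → z ∈ U → z ≢ v → Walk (U - v) z x

  record Region (U : Subset n) (x : Fin n) : Set where
    field
      root∈     : x ∈ U
      connected : ∀ {z} → z ∈ U → Walk U z x
      closed    : ∀ {z w} → z ∈ U → z ≢ x → Adj z w → w ∈ U

  module _ {U : Subset n} where

    link-sym : ∀ {x y} → Link U x y → Link U y x
    link-sym (x∈ , y∈ , inj₁ r) = y∈ , x∈ , inj₂ r
    link-sym (x∈ , y∈ , inj₂ r) = y∈ , x∈ , inj₁ r

    walk-reverse : ∀ {x y} → Walk U x y → Walk U y x
    walk-reverse = Star.reverse link-sym

    walk-source : ∀ {x y} → Walk U x y → x ≡ y ⊎ x ∈ U
    walk-source ε                 = inj₁ refl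
    walk-source ((x∈ , _ , _) ◅ _) = inj₂ x∈

    walk-target : ∀ {x y} → Walk U x y → x ≡ y ⊎ y ∈ U
    walk-target w with walk-source (walk-reverse w)
    ... | inj₁ y≡x = inj₁ (sym y≡x)
    ... | inj₂ y∈U = inj₂ y∈U

    walk-restrict : ∀ {V z b} → (∀ {w} → w ∈ U → Walk U w b → w ∈ V) →
                    Walk U z b → Walk V z b
    walk-restrict keep ε = ε
    walk-restrict keep (st@(z∈ , y∈ , zy) ◅ rest) =
      (keep z∈ (st ◅ rest) , keep y∈ rest , zy) ◅ walk-restrict keep rest

    walk-mono : ∀ {V x y} → U ⊆ V → Walk U x y → Walk V x y
    walk-mono U⊆V = walk-restrict (λ w∈U _ → U⊆V w∈U)

    walk-first-visit : ∀ {a z b} → z ∈ U → z ≢ a → Walk U z b →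
      Walk (U - a) z b ⊎ Σ (Fin n) λ q → q ∈ U - a × Walk (U - a) z q × Adj q a
    walk-first-visit z∈ z≢a ε = inj₁ ε
    walk-first-visit {a} {z} z∈ z≢a (_◅_ {j = y} (_ , y∈ , zy) rest) with y ≟ a
    ... | yes refl = inj₂ (z , z∈′ , ε , zy)
      where z∈′ = x∈p∧x≢y⇒x∈p-y z∈ z≢a
    ... | no y≢a with walk-first-visit y∈ y≢a rest
    ...   | inj₁ rest′ = inj₁ (step ◅ rest′)
      where step = x∈p∧x≢y⇒x∈p-y z∈ z≢a , x∈p∧x≢y⇒x∈p-y y∈ y≢a , zy
    ...   | inj₂ (q , q∈ , rest′ , qa) = inj₂ (q , q∈ , step ◅ rest′ , qa)
      where step = x∈p∧x≢y⇒x∈p-y z∈ z≢a , x∈p∧x≢y⇒x∈p-y y∈ y≢a , zy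

  walk-leave : ∀ {U a b} → Walk U a b → a ≢ b →
    Σ (Fin n) λ p → Adj a p × p ∈ U - a × Walk (U - a) p b
  walk-leave {U} {a} {b} w a≢b with walk-target w
  ... | inj₁ a≡b = ⊥-elim (a≢b a≡b)
  ... | inj₂ b∈U with walk-first-visit b∈U (a≢b ∘ sym) (walk-reverse w)
  ...   | inj₁ b→a = ⊥-elim ([ a≢b ∘ sym , (λ a∈ → x∈p-y⇒x≢y a∈ refl) ] (walk-target b→a))
  ...   | inj₂ (q , q∈ , b→q , inj₁ r) = q , inj₂ r , q∈ , walk-reverse b→q
  ...   | inj₂ (q , q∈ , b→q , inj₂ r) = q , inj₁ r , q∈ , walk-reverse b→q

  full-region : (∀ i j → EqClosure R i j) → ∀ x → Region ⊤ˢ x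
  full-region connected x = record
    { root∈     = ∈⊤
    ; connected = λ _ → Star.map full-link (connected _ x)
    ; closed    = λ _ _ _ → ∈⊤
    }
    where
    full-link : ∀ {i j} → SymClosure R i j → Link ⊤ˢ i j
    full-link (fwd r) = ∈⊤ , ∈⊤ , inj₁ r
    full-link (bwd r) = ∈⊤ , ∈⊤ , inj₂ r

  -- With r = 0 components v would have no label; with r′ ≥ 2 components after
  -- removing v, the vertices labelled 0 and 1 would still be joined through x.
  removable⇒¬cutvertex : ∀ {x v} → Removable ⊤ˢ x v → ¬ IsCutvertex R v
  removable⇒¬cutvertex {v = v} _ (zero , _ , (label , _) , _) with label (v , tt)
  ... | ()
  removable⇒¬cutvertex {v = v} removable
    (suc _ , _ , _ , (label , onto , kernel) , s≤s (s≤s _))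
    with onto zero | onto (suc zero)
  ... | (z₀ , z₀≢v) , z₀↦0 | (z₁ , z₁≢v) , z₁↦1 =
    0≢1 (trans (sym z₀↦0) (trans (Equivalence.from (kernel _ _) (inj₂ z₀⇝z₁)) z₁↦1))
    where
    z₀→z₁ : Walk (⊤ˢ - v) z₀ z₁
    z₀→z₁ = removable ∈⊤ z₀≢v ◅◅ walk-reverse (removable ∈⊤ z₁≢v)
    z₀⇝z₁ : Semipath (UndirRestr (_≢ v) R) z₀ z₁
    z₀⇝z₁ = walk⇒semipath _≟_
      (Star.map (λ (z∈ , w∈ , zw) → x∈p-y⇒x≢y z∈ , x∈p-y⇒x≢y w∈ , zw) z₀→z₁)
    0≢1 : ∀ {m} → Fin.zero {suc m} ≢ suc zero
    0≢1 ()

  walk? : (∀ x y → Dec (R x y)) → ∀ U z b → Dec (Walk U z b)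
  walk? R? U = walk?-acc (⊂-wellFounded U)
    where
    walk?-acc : ∀ {U} → Acc _⊂_ U → ∀ z b → Dec (Walk U z b)
    walk?-acc {U} (acc smaller) z b with z ≟ b
    ... | yes refl = yes ε
    ... | no z≢b with z ∈? U
    ...   | no z∉U = no (λ w → [ z≢b , z∉U ] (walk-source w))
    ...   | yes z∈U
      with any? (λ p → (R? z p ⊎-dec R? p z) ×-dec p ∈? U - z ×-dec
                       walk?-acc (smaller (x∈p⇒p-x⊂p z∈U)) p b)
    ...     | yes (p , zp , p∈ , p→b) =
              yes ((z∈U , x∈p-y⇒x∈p p∈ , zp) ◅ walk-mono x∈p-y⇒x∈p p→b)
    ...     | no none = no (λ w → none (walk-leave w z≢b))

module _ {T : Fin n → Fin n → Set} (T? : ∀ x y → Dec (T x y))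
         (no-return : ∀ {x y} → T x y → Star T y x → ⊥) where

  minimal-ancestor : ∀ {U x} → x ∈ U →
    Σ (Fin n) λ s → s ∈ U × Star T s x × (∀ {z} → z ∈ U → ¬ T z s)
  minimal-ancestor {U} = go (⊂-wellFounded U)
    where
    go : ∀ {U x} → Acc _⊂_ U → x ∈ U →
         Σ (Fin n) λ s → s ∈ U × Star T s x × (∀ {z} → z ∈ U → ¬ T z s)
    go {U} {x} (acc smaller) x∈U with any? (λ z → z ∈? U ×-dec T? z x)
    ... | no none = x , x∈U , ε , λ z∈U zx → none (_ , z∈U , zx)
    ... | yes (z , z∈U , zx) with go (smaller (x∈p⇒p-x⊂p x∈U)) z∈U-x
      where
      z∈U-x : z ∈ U - x
      z∈U-x = x∈p∧x≢y⇒x∈p-y z∈U (λ { refl → no-return zx ε })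
    ...   | s , s∈ , s→z , minimal = s , x∈p-y⇒x∈p s∈ , s→x , minimal′
      where
      s→x = s→z ◅◅ (zx ◅ ε)
      minimal′ : ∀ {w} → w ∈ U → ¬ T w s
      minimal′ {w} w∈U ws with w ≟ x
      ... | yes refl = no-return ws s→x
      ... | no w≢x = minimal (x∈p∧x≢y⇒x∈p-y w∈U w≢x) ws

module _ {n : ℕ} {R : Fin n → Fin n → Set} (R? : ∀ x y → Dec (R x y))
         (acyclic : ¬ DirCycle R) where

  no-return : ∀ {x y} → R x y → Star R y x → ⊥
  no-return r p with walk⇒semipath _≟_ p
  ... | vs , sp , unique = acyclic (_ , _ , vs , r , sp , unique)

  no-return-flip : ∀ {x y} → R y x → Star (flip R) y x → ⊥
  no-return-flip r p = no-return r (Star.reverse id p)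

  module _ {U : Subset n} {x : Fin n} (region : Region R U x) where
    open Region region

    source-outer : ∀ {s} → s ∈ U → s ≢ x → (∀ {z} → z ∈ U → ¬ R z s) → IsOuterC R s
    source-outer s∈U s≢x source ((j , js) , _) = source (closed s∈U s≢x (inj₂ js)) js

    sink-outer : ∀ {t} → t ∈ U → t ≢ x → (∀ {z} → z ∈ U → ¬ R t z) → IsOuterC R t
    sink-outer t∈U t≢x sink (_ , (j , tj)) = sink (closed t∈U t≢x (inj₁ tj)) tj

    outer-vertex : ∀ {y} → y ∈ U → y ≢ x → Σ (Fin n) λ v → v ∈ U × v ≢ x × IsOuterC R v
    outer-vertex y∈U y≢x
      with minimal-ancestor R? no-return root∈ | minimal-ancestor (flip R?) no-return-flip root∈
    ... | s , s∈U , _ , source | t , t∈U , _ , sink with s ≟ x | t ≟ x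
    ...   | no s≢x | _      = s , s∈U , s≢x , source-outer s∈U s≢x source
    ...   | yes _  | no t≢x = t , t∈U , t≢x , sink-outer t∈U t≢x sink
    ...   | yes refl | yes refl with walk-leave R (walk-reverse R (connected y∈U)) (y≢x ∘ sym)
    ...     | _ , inj₁ xp , p∈ , _ = ⊥-elim (sink (x∈p-y⇒x∈p p∈) xp)
    ...     | _ , inj₂ px , p∈ , _ = ⊥-elim (source (x∈p-y⇒x∈p p∈) px)

  OuterRemovable : Subset n → Fin n → Set
  OuterRemovable U x = Σ (Fin n) λ v → v ∈ U × v ≢ x × IsOuterC R v × Removable R U x v

  module Descent {U : Subset n} {x v : Fin n} (region : Region R U x)
                 (v∈U : v ∈ U) (v≢x : v ≢ x) where
    open Region region

    CutOff : Fin n → Set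
    CutOff w = w ∈ U × ¬ Walk R (U - v) w x

    cut-off? : ∀ w → Dec (CutOff w)
    cut-off? w = w ∈? U ×-dec ¬? (walk? R R? (U - v) w x)

    U′ : Subset n
    U′ = toSubset cut-off?

    x∉U′ : x ∉ U′
    x∉U′ x∈U′ = proj₂ (∈-toSubset⁻ cut-off? x∈U′) ε

    U′⊂U : U′ ⊂ U
    U′⊂U = proj₁ ∘ ∈-toSubset⁻ cut-off? , x , root∈ , x∉U′

    v-cut-off : ¬ Walk R (U - v) v x
    v-cut-off w = [ v≢x , (λ v∈ → x∈p-y⇒x≢y v∈ refl) ] (walk-source R w)

    U′⊆U : U′ ⊆ U
    U′⊆U = proj₁ U′⊂U

    region′ : Region R U′ v
    region′ = record { root∈ = v∈U′ ; connected = connected′ ; closed = closed′ }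
      where
      v∈U′ : v ∈ U′
      v∈U′ = ∈-toSubset⁺ cut-off? (v∈U , v-cut-off)

      connected′ : ∀ {z} → z ∈ U′ → Walk R U′ z v
      connected′ {z} z∈U′ with z ≟ v | ∈-toSubset⁻ cut-off? z∈U′
      ... | yes refl | _ = ε
      ... | no z≢v | z∈U , z↛x with walk-first-visit R z∈U z≢v (connected z∈U)
      ...   | inj₁ z→x = ⊥-elim (z↛x z→x)
      ...   | inj₂ (q , q∈ , z→q , qv) =
        walk-restrict R keep z→q ◅◅ ((keep q∈ ε , v∈U′ , qv) ◅ ε)
        where
        keep : ∀ {w} → w ∈ U - v → Walk R (U - v) w q → w ∈ U′
        keep w∈ w→q = ∈-toSubset⁺ cut-off?
          (x∈p-y⇒x∈p w∈ , λ w→x → z↛x (z→q ◅◅ walk-reverse R w→q ◅◅ w→x))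

      closed′ : ∀ {z w} → z ∈ U′ → z ≢ v → Adj R z w → w ∈ U′
      closed′ {z} {w} z∈U′ z≢v zw with ∈-toSubset⁻ cut-off? z∈U′
      ... | z∈U , z↛x = ∈-toSubset⁺ cut-off? (w∈U , w↛x)
        where
        w∈U : w ∈ U
        w∈U = closed z∈U (λ { refl → z↛x ε }) zw
        w↛x : ¬ Walk R (U - v) w x
        w↛x w→x with w ≟ v
        ... | yes refl = v-cut-off w→x
        ... | no w≢v =
          z↛x ((x∈p∧x≢y⇒x∈p-y z∈U z≢v , x∈p∧x≢y⇒x∈p-y w∈U w≢v , zw) ◅ w→x)

    module _ {v′ : Fin n} (v′∈U′ : v′ ∈ U′) where

      reaching-≢ : ∀ {w} → Walk R (U - v) w x → w ≢ v′
      reaching-≢ w→x refl = proj₂ (∈-toSubset⁻ cut-off? v′∈U′) w→x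

      reaching-avoids : ∀ {z} → Walk R (U - v) z x → Walk R (U - v′) z x
      reaching-avoids = walk-restrict R λ w∈ w→x →
        x∈p∧x≢y⇒x∈p-y (x∈p-y⇒x∈p w∈) (reaching-≢ w→x)

      removable-lift : v′ ≢ v → Removable R U′ v v′ → Removable R U x v′
      removable-lift v′≢v removable′ {z} z∈U z≢v′ with walk? R R? (U - v) z x
      ... | yes z→x = reaching-avoids z→x
      ... | no z↛x = walk-mono R (p⊆q⇒p-x⊆q-x U′⊆U) z→v ◅◅ v→x
        where
        z→v : Walk R (U′ - v′) z v
        z→v = removable′ (∈-toSubset⁺ cut-off? (z∈U , z↛x)) z≢v′
        v→x : Walk R (U - v′) v x
        v→x with walk-leave R (connected v∈U) v≢x
        ... | p , vp , p∈ , p→x =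
          ( x∈p∧x≢y⇒x∈p-y v∈U (v′≢v ∘ sym)
          , x∈p∧x≢y⇒x∈p-y (x∈p-y⇒x∈p p∈) (reaching-≢ p→x)
          , vp )
          ◅ reaching-avoids p→x

    descend : OuterRemovable U′ v → OuterRemovable U x
    descend (v′ , v′∈U′ , v′≢v , outer′ , removable′) =
      v′ , U′⊆U v′∈U′ , (λ { refl → x∉U′ v′∈U′ }) , outer′ ,
      removable-lift v′∈U′ v′≢v removable′

  removable-outer-vertex : ∀ {U x y} → Region R U x → y ∈ U → y ≢ x → OuterRemovable U x
  removable-outer-vertex {U} = go (⊂-wellFounded U)
    where
    go : ∀ {U x y} → Acc _⊂_ U → Region R U x → y ∈ U → y ≢ x → OuterRemovable U x
    go {U} {x} (acc smaller) region y∈U y≢x with outer-vertex region y∈U y≢x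
    ... | v , v∈U , v≢x , outer
      with any? (λ c → c ∈? U ×-dec ¬? (c ≟ v) ×-dec ¬? (walk? R R? (U - v) c x))
    ...   | no none = v , v∈U , v≢x , outer , λ {z} z∈U z≢v →
              decidable-stable (walk? R R? (U - v) z x) (λ z↛x → none (z , z∈U , z≢v , z↛x))
    ...   | yes (c , c∈U , c≢v , c↛x) =
              descend (go (smaller U′⊂U) region′ (∈-toSubset⁺ cut-off? (c∈U , c↛x)) c≢v)
      where open Descent region v∈U v≢x

  two-extremes : ∀ {x₀ y₀} → y₀ ≢ x₀ → (∀ i j → EqClosure R i j) →
    Σ (Fin n) λ i → Σ (Fin n) λ j → i ≢ j × IsExtreme R i × IsExtreme R j
  two-extremes y₀≢x₀ connected
    with removable-outer-vertex (full-region R connected _) ∈⊤ y₀≢x₀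
  ... | v₁ , _ , v₁≢x₀ , outer₁ , removable₁
    with removable-outer-vertex (full-region R connected v₁) ∈⊤ (v₁≢x₀ ∘ sym)
  ... | v₂ , _ , v₂≢v₁ , outer₂ , removable₂ =
    v₂ , v₁ , v₂≢v₁ , (outer₂ , removable⇒¬cutvertex R removable₂)
                    , (outer₁ , removable⇒¬cutvertex R removable₁)

spath⇒star : ∀ {Q : X → X → Set} {x y vs} → SPath Q x y vs → Star Q x y
spath⇒star here         = ε
spath⇒star (there q sp) = q ◅ spath⇒star sp

module _ {m k : ℕ} (D : Graph m k) (S : Subset m) {n : ℕ} (c : Fin k → Fin n) where
  open Graph D

  CArc? : ∀ i j → Dec (CArc D S c i j)
  CArc? i j = ¬? (i ≟ j) ×-dec any? (λ a → a ∈? S ×-dec c (W a) ≟ i ×-dec c (E a) ≟ j)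

  module _ (labelling : IsComponentLabelling D S n c)
           (separated : ∀ a → a ∈ S → c (W a) ≢ c (E a)) where

    edge-connects : ∀ {u u′} → UStep D (λ _ → ⊤) u u′ →
                    EqClosure (CArc D S c) (c u) (c u′)
    edge-connects {u} {u′} (a , _ , orient) with a ∈? S
    ... | yes a∈S = orient-arc orient ◅ ε
      where
      arc : CArc D S c (c (W a)) (c (E a))
      arc = separated a a∈S , a , a∈S , refl , refl
      orient-arc : (W a ≡ u × E a ≡ u′) ⊎ (W a ≡ u′ × E a ≡ u) →
                   SymClosure (CArc D S c) (c u) (c u′)
      orient-arc (inj₁ (refl , refl)) = fwd arc
      orient-arc (inj₂ (refl , refl)) = bwd arc
    ... | no a∉S = subst (EqClosure (CArc D S c) (c u)) same-component ε
      where
      same-component : c u ≡ c u′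
      same-component with u ≟ u′
      ... | yes refl = refl
      ... | no u≢u′ = Equivalence.from (proj₂ labelling u u′)
            (inj₂ (_ , there (a , a∉S , orient) here , (u≢u′ ∷ []) ∷ [] ∷ []))

    componential-connected : WeaklyConnected D → ∀ i j → EqClosure (CArc D S c) i j
    componential-connected connected i j with proj₁ labelling i | proj₁ labelling j
    ... | u , refl | w , refl with u ≟ w
    ...   | yes refl = ε
    ...   | no u≢w with connected u w u≢w
    ...     | _ , u⇝w , _ = Star.kleisliStar c edge-connects (spath⇒star u⇝w)

proposition1p6p2 : ∀ {m k : ℕ} (D : Graph m k) → IsDGraph D →
    (S : Subset m) (n : ℕ) (c : Fin k → Fin n) → IsComponentLabelling D S n c →
    IsStrictCutset D S n c →
    Σ (Fin n) λ i → Σ (Fin n) λ j →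
      i ≢ j × IsExtreme (CArc D S c) i × IsExtreme (CArc D S c) j
proposition1p6p2 D (_ , _ , connected , _) S (suc (suc _)) c labelling
                 (_ , s≤s (s≤s _) , separated , acyclic) =
  two-extremes (CArc? D S c) acyclic {x₀ = zero} {y₀ = suc zero} (λ ())
    (componential-connected D S c labelling separated connected)
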